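{- Let $T$ be a text of length $n$, let $\theta \ge 2$ be an integer, and consider the plcpcomp procedure on $T$ with threshold $\theta$ (defined in the context). Consider any state reached by this procedure, consisting of the current array $P$ and the set of referencing factors created so far. If the text position $i$ is a maximal peak with respect to this state, then the procedure, continued from this state, eventually creates the referencing factor $T[i..i+P[i]-1]$, where $P[i]$ is the value in the given state.
   Context: A text $T=T[1..n]$ is a string over an integer alphabet whose last character $T[n]=\$$ occurs nowhere else and is lexicographically smaller than all other characters; $T[i..]$ denotes the suffix starting at position $i$. For each position $i$, let $\Phi[i]$ be the starting position of the suffix that immediately precedes $T[i..]$ in the lexicographic order of all suffixes of $T$ (and $\Phi[i]:=n$ if $T[i..]$ is the smallest suffix), and let $\mathrm{PLCP}[i]$ be the length of the longest common prefix of $T[i..]$ and $T[\Phi[i]..]$ (and $0$ if $T[i..]$ is the smallest suffix). The plcpcomp procedure with threshold $\theta$ maintains a rewritable integer array $P[1..n]$, initially $P=\mathrm{PLCP}$, and a set of referencing factors, initially empty. It repeats: (1) let $i$ be the leftmost position with $P[i]\ge P[j]$ for all $j$; (2) if $P[i]<\theta$, stop; (3) create the referencing factor $T[i..i+P[i]-1]$ with reference $(\Phi[i],P[i])$; (4) with $\ell:=P[i]$ (value before this step), set $P[j]\gets\min(P[j],i-j)$ for every $j\in[i-\ell,i)$ (rule D) and set $P[i+k]\gets 0$ for every $k\in[0,\ell)$ (rule R); then repeat. With respect to a state (current array $P$ and current set of created referencing factors), a position $i$ is a peak if $P[i]\ge\theta$ and at least one of the following holds: $i=1$; $P[i-1]<P[i]$;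 some created referencing factor ends at position $i-1$. A peak $i$ is interesting if there is no position $j$ with $i\in(j,j+P[j])$ (open interval) and $P[j]\ge P[i]$. An interesting peak $i$ is maximal if there is no interesting peak $j$ with $j\in(i,i+P[i])$. -}

module Defs where

open import Data.Nat using (ℕ; zero; suc; _+_; _∸_; _≤_; _<_; _⊓_; _≤?_; _<?_)
open import Data.Bool using (Bool; true; false; if_then_else_; _∧_)
open import Data.List using (List; []; _∷_; map; upTo)
open import Data.List.Membership.Propositional using (_∈_)
open import Data.List.Relation.Binary.Lex.Core using (Lex-<)
open import Data.Product using (Σ; ∃; _×_; _,_; proj₁; proj₂)
open import Data.Sum using (_⊎_)
open import Relation.Nullary using (¬_)
open import Relation.Nullary.Decidable using (⌊_⌋)
open import Relation.Binary.PropositionalEquality using (_≡_)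
open import Relation.Binary.Construct.Closure.ReflexiveTransitive using (Star)

-- Texts.  Positions are 1-based: a text of length n is T : ℕ → ℕ,
-- of which only T 1, …, T n matter.

InRange : ℕ → ℕ → Set
InRange n i = 1 ≤ i × i ≤ n

-- T is a text of length n: T[n] = $ is strictly smaller than every other
-- character (hence occurs nowhere else).
IsText : ℕ → (ℕ → ℕ) → Set
IsText n T = 1 ≤ n × (∀ i → 1 ≤ i → i < n → T n < T i)

suf : (ℕ → ℕ) → ℕ → ℕ → List ℕ
suf T n i = map (λ k → T (i + k)) (upTo (suc n ∸ i))

_≺_ : List ℕ → List ℕ → Set
xs ≺ ys = Lex-< _≡_ _<_ xs ys

lcp : List ℕ → List ℕ → ℕ
lcp [] _ = 0
lcp (_ ∷ _) [] = 0
lcp (x ∷ xs) (y ∷ ys) = if ⌊ x Data.Nat.≟ y ⌋ then suc (lcp xs ys) else 0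

SmallestSuf : ℕ → (ℕ → ℕ) → ℕ → Set
SmallestSuf n T i = ∀ j → InRange n j → ¬ (suf T n j ≺ suf T n i)

ImmPred : ℕ → (ℕ → ℕ) → ℕ → ℕ → Set
ImmPred n T j i =
  InRange n j × suf T n j ≺ suf T n i ×
  (∀ k → InRange n k → suf T n k ≺ suf T n i → ¬ (suf T n j ≺ suf T n k))

IsPhiPLCP : ℕ → (ℕ → ℕ) → (ℕ → ℕ) → (ℕ → ℕ) → Set
IsPhiPLCP n T Φ PLCP = ∀ i → InRange n i →
  (SmallestSuf n T i × Φ i ≡ n × PLCP i ≡ 0)
  ⊎ (ImmPred n T (Φ i) i × PLCP i ≡ lcp (suf T n i) (suf T n (Φ i)))

-- a referencing factor: (start position, length, reference position)
Factor : Set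
Factor = ℕ × ℕ × ℕ

State : Set
State = (ℕ → ℕ) × List Factor

LeftmostMax : ℕ → (ℕ → ℕ) → ℕ → Set
LeftmostMax n P i =
  InRange n i × (∀ j → InRange n j → P j ≤ P i) × (∀ j → 1 ≤ j → j < i → P j < P i)

-- rules R and D applied at position i with ℓ = P[i] (old value)
update : ℕ → ℕ → (ℕ → ℕ) → ℕ → ℕ
update i ℓ P j =
  if ⌊ i ≤? j ⌋ ∧ ⌊ j <? i + ℓ ⌋ then 0
  else if ⌊ i ∸ ℓ ≤? j ⌋ ∧ ⌊ j <? i ⌋ then P j ⊓ (i ∸ j)
  else P j

data Step (n θ : ℕ) (Φ : ℕ → ℕ) : State → State → Set where
  step : ∀ {P F i} → LeftmostMax n P i → θ ≤ P i →
         Step n θ Φ (P , F) (update i (P i) P , (i , P i , Φ i) ∷ F)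

initial : (ℕ → ℕ) → State
initial PLCP = (PLCP , [])

Reaches : ℕ → ℕ → (ℕ → ℕ) → State → State → Set
Reaches n θ Φ = Star (Step n θ Φ)

Peak : ℕ → ℕ → State → ℕ → Set
Peak n θ (P , F) i =
  InRange n i × θ ≤ P i ×
  (i ≡ 1 ⊎ P (i ∸ 1) < P i ⊎ ∃ λ f → f ∈ F × proj₁ f + proj₁ (proj₂ f) ≡ i)
  -- a factor (s, ℓ, r) ends at i-1 iff s + ℓ = i

InterestingPeak : ℕ → ℕ → State → ℕ → Set
InterestingPeak n θ s i =
  Peak n θ s i ×
  ¬ (∃ λ j → InRange n j × j < i × i < j + proj₁ s j × proj₁ s i ≤ proj₁ s j)

MaximalPeak : ℕ → ℕ → State → ℕ → Set
MaximalPeak n θ s i =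
  InterestingPeak n θ s i ×
  ¬ (∃ λ j → InterestingPeak n θ s j × i < j × j < i + proj₁ s i)

module Submission where

-- Idea.  Call position i of an array Q *dominant* if every position j < i whose
-- would-be factor covers i (i < j + Q j) has Q j < Q i, and every position
-- j ∈ (i, i + Q i) has Q j ≤ Q i.
--
--  * A maximal peak dominates the current array: the first condition is
--    interestingness; if some j ∈ (i, i + P i) had P j > P i, the leftmost
--    maximum of P on (i, j] would be an interesting peak inside the factor of
--    i, contradicting maximality.
--  * While i is dominant with Q i ≥ θ, plcpcomp never stops, and a step at the
--    leftmost maximum m ≠ i neither covers i (rule R) nor is covered by i
--    (rule D), so Q i is unchanged; as updates only lower values, i stays
--    dominant.  Each step zeroes Q m > 0, so the weight Q 1 + ⋯ + Q n strictly
--    decreases and, by well-founded induction, the step at i itself must come.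

open import Defs
open import Data.Nat using (ℕ; _≤_)
open import Data.Product using (∃; _×_; _,_; proj₁; proj₂)
open import Data.List.Membership.Propositional using (_∈_)

open import Data.Nat using (zero; suc; _+_; _∸_; _<_; _⊓_; _≤?_; _<?_; _≟_; z≤n; s≤s)
open import Data.Nat.Properties
open import Data.Nat.Induction using (<-wellFounded)
open import Induction.WellFounded using (Acc; acc)
open import Data.List using (_∷_)
open import Data.List.Relation.Unary.Any using (here)
open import Data.Sum using (_⊎_; inj₁; inj₂)
open import Data.Empty using (⊥-elim)
open import Relation.Nullary using (yes; no; ¬_)
open import Relation.Binary using (tri<; tri≈; tri>)
open import Relation.Binary.PropositionalEquality using (_≡_; _≢_; refl; sym; cong; subst)
open import Relation.Binary.Construct.Closure.ReflexiveTransitive using (ε; _◅_)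

update-cases : ∀ m ℓ Q j →
  (m ≤ j × j < m + ℓ × update m ℓ Q j ≡ 0)
  ⊎ (j < m × update m ℓ Q j ≡ Q j ⊓ (m ∸ j))
  ⊎ (¬ (m ≤ j × j < m + ℓ) × update m ℓ Q j ≡ Q j)
update-cases m ℓ Q j with m ≤? j | j <? m + ℓ | m ∸ ℓ ≤? j | j <? m
... | yes m≤j | yes j<m+ℓ | _     | _     = inj₁ (m≤j , j<m+ℓ , refl)
... | yes m≤j | no _      | _     | yes j<m = ⊥-elim (<⇒≱ j<m m≤j)
... | yes _   | no j≮m+ℓ  | yes _ | no _  = inj₂ (inj₂ ((λ (_ , j<m+ℓ) → j≮m+ℓ j<m+ℓ) , refl))
... | yes _   | no j≮m+ℓ  | no _  | _     = inj₂ (inj₂ ((λ (_ , j<m+ℓ) → j≮m+ℓ j<m+ℓ) , refl))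
... | no _    | _         | yes _ | yes j<m = inj₂ (inj₁ (j<m , refl))
... | no m≰j  | _         | yes _ | no _  = inj₂ (inj₂ ((λ (m≤j , _) → m≰j m≤j) , refl))
... | no m≰j  | _         | no _  | _     = inj₂ (inj₂ ((λ (m≤j , _) → m≰j m≤j) , refl))

update-≤ : ∀ m ℓ Q j → update m ℓ Q j ≤ Q j
update-≤ m ℓ Q j with update-cases m ℓ Q j
... | inj₁ (_ , _ , eq)     = ≤-trans (≤-reflexive eq) z≤n
... | inj₂ (inj₁ (_ , eq)) = ≤-trans (≤-reflexive eq) (m⊓n≤m (Q j) (m ∸ j))
... | inj₂ (inj₂ (_ , eq)) = ≤-reflexive eq

update-self : ∀ m ℓ Q → 0 < ℓ → update m ℓ Q m ≡ 0
update-self m ℓ Q ℓ>0 with update-cases m ℓ Q m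
... | inj₁ (_ , _ , eq)       = eq
... | inj₂ (inj₁ (m<m , _))   = ⊥-elim (<-irrefl refl m<m)
... | inj₂ (inj₂ (outside , _)) = ⊥-elim (outside (≤-refl , m<m+n m ℓ>0))

update-outside : ∀ m ℓ Q j → ¬ (m ≤ j × j < m + ℓ) → ¬ (j < m × m < j + Q j) →
                 update m ℓ Q j ≡ Q j
update-outside m ℓ Q j notInside notCovering with update-cases m ℓ Q j
... | inj₁ (m≤j , j<m+ℓ , _) = ⊥-elim (notInside (m≤j , j<m+ℓ))
... | inj₂ (inj₂ (_ , eq))   = eq
... | inj₂ (inj₁ (j<m , eq)) = subst (_≡ Q j) (sym eq) (m≤n⇒m⊓n≡m Qj≤m∸j)
  where
  Qj≤m∸j : Q j ≤ m ∸ j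
  Qj≤m∸j = m+n≤o⇒m≤o∸n (Q j)
             (subst (_≤ m) (+-comm j (Q j)) (≮⇒≥ (λ m<j+Qj → notCovering (j<m , m<j+Qj))))

sumTo : (ℕ → ℕ) → ℕ → ℕ
sumTo Q zero    = 0
sumTo Q (suc k) = Q (suc k) + sumTo Q k

sumTo-mono : ∀ {Q′ Q} k → (∀ j → 1 ≤ j → j ≤ k → Q′ j ≤ Q j) → sumTo Q′ k ≤ sumTo Q k
sumTo-mono zero    _   = z≤n
sumTo-mono (suc k) Q′≤Q =
  +-mono-≤ (Q′≤Q (suc k) (s≤s z≤n) ≤-refl) (sumTo-mono k (λ j 1≤j j≤k → Q′≤Q j 1≤j (m≤n⇒m≤1+n j≤k)))

sumTo-strict : ∀ {Q′ Q} k c → (∀ j → 1 ≤ j → j ≤ k → Q′ j ≤ Q j) →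
               1 ≤ c → c ≤ k → Q′ c < Q c → sumTo Q′ k < sumTo Q k
sumTo-strict zero    c _    1≤c c≤0   _ = ⊥-elim (<⇒≱ 1≤c c≤0)
sumTo-strict (suc k) c Q′≤Q 1≤c c≤1+k Q′c<Qc with m≤n⇒m<n∨m≡n c≤1+k
... | inj₂ refl  = +-mono-<-≤ Q′c<Qc (sumTo-mono k (λ j 1≤j j≤k → Q′≤Q j 1≤j (m≤n⇒m≤1+n j≤k)))
... | inj₁ c<1+k =
  +-mono-≤-< (Q′≤Q (suc k) (s≤s z≤n) ≤-refl)
             (sumTo-strict k c (λ j 1≤j j≤k → Q′≤Q j 1≤j (m≤n⇒m≤1+n j≤k)) 1≤c (≤-pred c<1+k) Q′c<Qc)

LeftmostMaxOn : (ℕ → ℕ) → ℕ → ℕ → ℕ → Set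
LeftmostMaxOn Q a b m =
  (a < m × m ≤ b) × (∀ j → a < j → j ≤ b → Q j ≤ Q m) × (∀ j → a < j → j < m → Q j < Q m)

leftmostMaxOn : ∀ Q a b → a < b → ∃ (LeftmostMaxOn Q a b)
leftmostMaxOn Q a (suc b) a<1+b with m≤n⇒m<n∨m≡n (≤-pred a<1+b)
... | inj₂ refl = suc a , (≤-refl , ≤-refl) , onlyPoint , λ j a<j j<1+a → ⊥-elim (<⇒≱ a<j (≤-pred j<1+a))
  where
  onlyPoint : ∀ j → a < j → j ≤ suc a → Q j ≤ Q (suc a)
  onlyPoint j a<j j≤1+a = ≤-reflexive (cong Q (≤-antisym j≤1+a a<j))
... | inj₁ a<b with leftmostMaxOn Q a b a<b
...   | m , (a<m , m≤b) , max , left with Q m <? Q (suc b)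
...     | yes Qm<Qb = suc b , (a<1+b , ≤-refl) , max′ , left′
  where
  left′ : ∀ j → a < j → j < suc b → Q j < Q (suc b)
  left′ j a<j j<1+b = ≤-<-trans (max j a<j (≤-pred j<1+b)) Qm<Qb
  max′ : ∀ j → a < j → j ≤ suc b → Q j ≤ Q (suc b)
  max′ j a<j j≤1+b with m≤n⇒m<n∨m≡n j≤1+b
  ... | inj₁ j<1+b = <⇒≤ (left′ j a<j j<1+b)
  ... | inj₂ refl  = ≤-refl
...     | no Qm≮Qb = m , (a<m , m≤n⇒m≤1+n m≤b) , max′ , left
  where
  max′ : ∀ j → a < j → j ≤ suc b → Q j ≤ Q m
  max′ j a<j j≤1+b with m≤n⇒m<n∨m≡n j≤1+b
  ... | inj₁ j<1+b = max j a<j (≤-pred j<1+b)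
  ... | inj₂ refl  = ≮⇒≥ Qm≮Qb

leftmostMax : ∀ n Q → 1 ≤ n → ∃ (LeftmostMax n Q)
leftmostMax n Q 1≤n with leftmostMaxOn Q 0 n 1≤n
... | m , range , max , left = m , range , (λ j (1≤j , j≤n) → max j 1≤j j≤n) , left

-- If k > i beats Q i and every position strictly between i and k, then Q rises
-- at k: Q (k ∸ 1) < Q k.  This makes a leftmost maximum on (i, j] a peak.
leftmostMax-rises : ∀ (Q : ℕ → ℕ) {i} k → i < k → Q i < Q k →
                    (∀ j → i < j → j < k → Q j < Q k) → Q (k ∸ 1) < Q k
leftmostMax-rises Q (suc k) i<1+k Qi<Qk left with m≤n⇒m<n∨m≡n (≤-pred i<1+k)
... | inj₁ i<k  = left k i<k ≤-refl
... | inj₂ refl = Qi<Qk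

Dominant : ℕ → (ℕ → ℕ) → ℕ → Set
Dominant n Q i =
  (∀ j → InRange n j → j < i → i < j + Q j → Q j < Q i) ×
  (∀ j → InRange n j → i < j → j < i + Q i → Q j ≤ Q i)

dominant-mono : ∀ {n Q′ Q i} → (∀ j → InRange n j → Q′ j ≤ Q j) → Q′ i ≡ Q i →
                Dominant n Q i → Dominant n Q′ i
dominant-mono {n} {Q′} {Q} {i} Q′≤Q Q′i≡Qi (covering , inside) rewrite Q′i≡Qi =
  covering′ , λ j rj i<j j<i+Qi → ≤-trans (Q′≤Q j rj) (inside j rj i<j j<i+Qi)
  where
  covering′ : ∀ j → InRange n j → j < i → i < j + Q′ j → Q′ j < Q i
  covering′ j rj j<i i<j+Q′j =
    ≤-<-trans (Q′≤Q j rj) (covering j rj j<i (<-≤-trans i<j+Q′j (+-monoʳ-≤ j (Q′≤Q j rj))))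

-- A step at the leftmost maximum m ≠ i spares a dominant position i: m cannot
-- cover i (it would be smaller than Q i), and i cannot cover m (m, lying right
-- of i, would have to exceed Q i).
update-spares-dominant : ∀ {n Q i m} → Dominant n Q i → InRange n i → LeftmostMax n Q m →
                         m ≢ i → update m (Q m) Q i ≡ Q i
update-spares-dominant {n} {Q} {i} {m} (covering , inside) ri (rm , max , left) m≢i =
  update-outside m (Q m) Q i notInside notCovering
  where
  notInside : ¬ (m ≤ i × i < m + Q m)
  notInside (m≤i , i<m+Qm) = <⇒≱ (covering m rm (≤∧≢⇒< m≤i m≢i) i<m+Qm) (max i ri)
  notCovering : ¬ (i < m × m < i + Q i)
  notCovering (i<m , m<i+Qi) = <⇒≱ (left i (proj₁ ri) i<m) (inside m rm i<m m<i+Qi)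

update-decreases : ∀ n m Q → InRange n m → 0 < Q m → sumTo (update m (Q m) Q) n < sumTo Q n
update-decreases n m Q (1≤m , m≤n) Qm>0 =
  sumTo-strict n m (λ j _ _ → update-≤ m (Q m) Q j) 1≤m m≤n
    (subst (_< Q m) (sym (update-self m (Q m) Q Qm>0)) Qm>0)

dominant⇒factor : ∀ {n θ} (Φ : ℕ → ℕ) → 0 < θ → ∀ {i} → InRange n i →
  ∀ Q F → Acc _<_ (sumTo Q n) → Dominant n Q i → θ ≤ Q i →
  ∃ λ s′ → Reaches n θ Φ (Q , F) s′ × (i , Q i , Φ i) ∈ proj₂ s′
dominant⇒factor {n} {θ} Φ θ>0 {i} ri Q F (acc smaller) dom θ≤Qi
  with leftmostMax n Q (≤-trans (proj₁ ri) (proj₂ ri))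
... | m , lmax@(rm , max , _) with m ≟ i
...   | yes refl = _ , step lmax θ≤Qi ◅ ε , here refl
...   | no m≢i   = prepend-step rest
  where
  θ≤Qm : θ ≤ Q m
  θ≤Qm = ≤-trans θ≤Qi (max i ri)
  Q′ : ℕ → ℕ
  Q′ = update m (Q m) Q
  spared : Q′ i ≡ Q i
  spared = update-spares-dominant dom ri lmax m≢i
  rest : ∃ λ s′ → Reaches n θ Φ (Q′ , (m , Q m , Φ m) ∷ F) s′ × (i , Q′ i , Φ i) ∈ proj₂ s′
  rest = dominant⇒factor Φ θ>0 ri Q′ _
           (smaller (update-decreases n m Q rm (<-≤-trans θ>0 θ≤Qm)))
           (dominant-mono (λ j _ → update-≤ m (Q m) Q j) spared dom)
           (subst (θ ≤_) (sym spared) θ≤Qi)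
  prepend-step : (∃ λ s′ → Reaches n θ Φ (Q′ , (m , Q m , Φ m) ∷ F) s′ × (i , Q′ i , Φ i) ∈ proj₂ s′) →
                 ∃ λ s′ → Reaches n θ Φ (Q , F) s′ × (i , Q i , Φ i) ∈ proj₂ s′
  prepend-step (s′ , reach , mem) =
    s′ , step lmax θ≤Qm ◅ reach , subst (λ v → (i , v , Φ i) ∈ proj₂ s′) spared mem

interesting-beyond : ∀ {n θ P F i j} → InterestingPeak n θ (P , F) i →
  InRange n j → i < j → P i < P j →
  ∃ λ k → InterestingPeak n θ (P , F) k × i < k × k ≤ j
interesting-beyond {n} {θ} {P} {F} {i} {j} ((ri , θ≤Pi , _) , uncovered) rj i<j Pi<Pj
  with leftmostMaxOn P i j i<j
... | k , (i<k , k≤j) , max , left =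
  k , ((rk , ≤-trans θ≤Pi (<⇒≤ Pi<Pk) , inj₂ (inj₁ rises)) , uncoveredK) , i<k , k≤j
  where
  Pi<Pk : P i < P k
  Pi<Pk = <-≤-trans Pi<Pj (max j i<j ≤-refl)
  rk : InRange n k
  rk = ≤-trans (proj₁ ri) (<⇒≤ i<k) , ≤-trans k≤j (proj₂ rj)
  rises : P (k ∸ 1) < P k
  rises = leftmostMax-rises P k i<k Pi<Pk left
  uncoveredK : ¬ (∃ λ j′ → InRange n j′ × j′ < k × k < j′ + P j′ × P k ≤ P j′)
  uncoveredK (j′ , rj′ , j′<k , k<cov , Pk≤Pj′) with <-cmp j′ i
  ... | tri< j′<i _ _ = uncovered (j′ , rj′ , j′<i , <-trans i<k k<cov , ≤-trans (<⇒≤ Pi<Pk) Pk≤Pj′)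
  ... | tri≈ _ refl _ = <⇒≱ Pi<Pk Pk≤Pj′
  ... | tri> _ _ i<j′ = <⇒≱ (left j′ i<j′ j′<k) Pk≤Pj′

maximalPeak⇒dominant : ∀ {n θ P F i} → MaximalPeak n θ (P , F) i → Dominant n P i
maximalPeak⇒dominant {n} {θ} {P} {F} {i} (interesting@(_ , uncovered) , nothingInside) =
  covering , inside
  where
  covering : ∀ j → InRange n j → j < i → i < j + P j → P j < P i
  covering j rj j<i i<j+Pj = ≰⇒> (λ Pi≤Pj → uncovered (j , rj , j<i , i<j+Pj , Pi≤Pj))
  inside : ∀ j → InRange n j → i < j → j < i + P i → P j ≤ P i
  inside j rj i<j j<i+Pi = ≮⇒≥ λ Pi<Pj →
    let k , interestingK , i<k , k≤j = interesting-beyond interesting rj i<j Pi<Pj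
    in nothingInside (k , interestingK , i<k , ≤-<-trans k≤j j<i+Pi)

lemma1 : (n : ℕ) (T : ℕ → ℕ) → IsText n T →
         (Φ PLCP : ℕ → ℕ) → IsPhiPLCP n T Φ PLCP →
         (θ : ℕ) → 2 ≤ θ →
         (s : State) → Reaches n θ Φ (initial PLCP) s →
         (i : ℕ) → MaximalPeak n θ s i →
         ∃ λ s′ → Reaches n θ Φ s s′ × (i , proj₁ s i , Φ i) ∈ proj₂ s′
lemma1 n T _ Φ PLCP _ θ 2≤θ (P , F) _ i maximal@(((ri , θ≤Pi , _) , _) , _) =
  dominant⇒factor Φ (≤-trans (s≤s z≤n) 2≤θ) ri P F (<-wellFounded (sumTo P n))
    (maximalPeak⇒dominant maximal) θ≤Pi
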